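{- Let $G$ be a graph with $G\neq 2K_1$. Then $G\in\mathrm{BP2}\setminus\mathrm{BP1}$ if and only if the complement $\bar G$ is connected and $\bar G$ has either a cut vertex or a disconnected vertex cut.
   Context: All graphs are finite, simple and undirected. A biclique of a graph $G$ is a subgraph of $G$ isomorphic to $K_1$ or to $K_{m,n}$ for some $m,n\ge1$. BP$k$ is the set of graphs whose vertex set can be covered by at most $k$ bicliques (equivalently, partitioned into at most $k$ parts, each the vertex set of a biclique). $\bar G$ is the complement of $G$; $2K_1$ is the edgeless graph on two vertices. A cut vertex of a connected graph $H$ is a vertex $v$ with $H-v$ disconnected. A vertex cut of a connected graph $H$ is a set $X\subseteq V(H)$ with $H-X$ disconnected; it is a disconnected vertex cut if moreover the induced subgraph $H[X]$ is disconnected. -}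

module Defs where

open import Data.Nat using (ℕ; _≤_)
open import Data.Fin using (Fin; _≟_)
open import Data.Bool using (Bool; true; false; not; _∧_; T)
open import Data.Bool.Properties using (∧-zeroʳ)
open import Data.List using (List; length)
open import Data.List.Relation.Unary.Any using (Any)
open import Data.Product using (Σ; ∃; _×_; _,_)
open import Data.Sum using (_⊎_)
open import Relation.Nullary using (¬_; yes; no)
open import Relation.Nullary.Decidable using (⌊_⌋)
open import Relation.Binary.PropositionalEquality using (_≡_; refl; sym; cong₂)

record Graph : Set where
  field
    n      : ℕ
    adj    : Fin n → Fin n → Bool
    adj-sym    : ∀ u v → adj u v ≡ adj v u
    adj-irrefl : ∀ v → adj v v ≡ false
open Graph public

private
  ≟-sym : ∀ {m} (u v : Fin m) → ⌊ u ≟ v ⌋ ≡ ⌊ v ≟ u ⌋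
  ≟-sym u v with u ≟ v | v ≟ u
  ... | yes _  | yes _  = refl
  ... | no _   | no _   = refl
  ... | yes p  | no ¬q  = Relation.Nullary.contradiction (sym p) ¬q
    where import Relation.Nullary
  ... | no ¬p  | yes q  = Relation.Nullary.contradiction (sym q) ¬p
    where import Relation.Nullary

  ≟-refl : ∀ {m} (v : Fin m) → ⌊ v ≟ v ⌋ ≡ true
  ≟-refl v with v ≟ v
  ... | yes _ = refl
  ... | no ¬p = Relation.Nullary.contradiction refl ¬p
    where import Relation.Nullary

complement : Graph → Graph
complement G = record
  { n = n G
  ; adj = λ u v → not (adj G u v) ∧ not ⌊ u ≟ v ⌋
  ; adj-sym = λ u v → cong₂ (λ a b → not a ∧ not b) (adj-sym G u v) (≟-sym u v)
  ; adj-irrefl = λ v → helper v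
  }
  where
  helper : ∀ v → not (adj G v v) ∧ not ⌊ v ≟ v ⌋ ≡ false
  helper v with v ≟ v
  ... | yes _ = ∧-zeroʳ (not (adj G v v))
  ... | no ¬p = Relation.Nullary.contradiction refl ¬p
    where import Relation.Nullary

IsTwoK1 : Graph → Set
IsTwoK1 G = (n G ≡ 2) × (∀ u v → adj G u v ≡ false)

VSet : Graph → Set
VSet G = Fin (n G) → Bool

-- Walks inside a vertex subset S (u and v joined by a walk all of whose
-- vertices lie in S), i.e. reachability in the induced subgraph H[S].
data Reach (H : Graph) (S : VSet H) : Fin (n H) → Fin (n H) → Set where
  here : ∀ {u} → T (S u) → Reach H S u u
  step : ∀ {u w v} → T (S u) → T (adj H u w) → Reach H S w v → Reach H S u v

ConnectedOn : (H : Graph) → VSet H → Set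
ConnectedOn H S = (∃ λ v → T (S v)) × (∀ u v → T (S u) → T (S v) → Reach H S u v)

-- H[S] is disconnected: it has two vertices not joined inside S
-- (so the empty graph is neither connected nor disconnected).
DisconnectedOn : (H : Graph) → VSet H → Set
DisconnectedOn H S = Σ (Fin (n H)) λ u → Σ (Fin (n H)) λ v →
  T (S u) × T (S v) × ¬ Reach H S u v

Connected : Graph → Set
Connected H = ConnectedOn H (λ _ → true)

minus : (H : Graph) → VSet H → VSet H
minus H X v = not (X v)

IsCutVertex : (H : Graph) → Fin (n H) → Set
IsCutVertex H v = DisconnectedOn H (λ u → not ⌊ u ≟ v ⌋)

HasCutVertex : Graph → Set
HasCutVertex H = ∃ λ v → IsCutVertex H v

IsVertexCut : (H : Graph) → VSet H → Set
IsVertexCut H X = DisconnectedOn H (minus H X)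

HasDisconnectedVertexCut : Graph → Set
HasDisconnectedVertexCut H = ∃ λ X → IsVertexCut H X × DisconnectedOn H X

-- A biclique of G: a K₁, or a (not necessarily induced) subgraph
-- isomorphic to K_{m,n} (m,n ≥ 1), given by disjoint nonempty sides A, B
-- with every A–B pair adjacent.
data Biclique (G : Graph) : Set where
  single   : Fin (n G) → Biclique G
  complete : (A B : VSet G) →
             (∃ λ a → T (A a)) → (∃ λ b → T (B b)) →
             (∀ v → ¬ (T (A v) × T (B v))) →
             (∀ a b → T (A a) → T (B b) → T (adj G a b)) →
             Biclique G

_∈B_ : ∀ {G} → Fin (n G) → Biclique G → Set
v ∈B single u                  = v ≡ u
v ∈B complete A B _ _ _ _      = T (A v) ⊎ T (B v)

BP : ℕ → Graph → Set
BP k G = Σ (List (Biclique G)) λ L → (length L ≤ k) × (∀ v → Any (v ∈B_) L)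

module Submission where

-- Write H for the complement of G. Everything rests on two facts about H.
-- (1) If (A , B) are the sides of a complete bipartite subgraph of G, then H
--     has no edge between A and B, so a walk of H inside A ∪ B never changes
--     side (walk-stays-left, separated).
-- (2) If H[S] is disconnected, the component C of a vertex in H[S] and S ∖ C
--     are completely joined in G, so S lies in one biclique of G (split).
--     This needs reachability in H[S] to be decidable, which we get by
--     saturating a vertex under "add the neighbours inside S": an inflationary
--     operator on subsets of a finite set reaches a closed set (Saturation).
-- From (1) and (2): for G with two vertices, G ∉ BP1 iff H is connected; a cut
-- vertex w of H yields the cover {w} ∪ split(H - w), and a disconnected vertex
-- cut X the cover split(H - X) ∪ split(H[X]). Conversely, for a cover of
-- G ∉ BP1 by two bicliques: two singletons force G = 2K₁; a singleton {a} and
-- a proper biclique make a a cut vertex of H; two proper bicliques (A₁,B₁),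
-- (A₂,B₂), oriented so that A₁ ⊄ A₂ ∪ B₂ and A₂ ⊄ A₁ ∪ B₁, give the
-- disconnected vertex cut B₁ ∪ (V ∖ (A₂ ∪ B₂)) when B₂ ⊄ B₁ (symmetrically when
-- B₁ ⊄ B₂), while B₁ = B₂ would merge them into the single biclique (V ∖ B₁ , B₁).

open import Data.Bool using (Bool; true; false; not; _∧_; _∨_; T)
open import Data.Bool.Properties using (T-∧; T-∨; T-≡; T-not-≡)
open import Data.Empty using (⊥; ⊥-elim)
open import Data.Fin using (Fin; zero; suc; _≟_)
open import Data.Fin.Properties using (any?; ¬∀⟶∃¬; injective⇒≤)
open import Data.Fin.Subset using (_∈_; ∣_∣)
open import Data.Fin.Subset.Properties using (∣p∣≤n; p⊂q⇒∣p∣<∣q∣)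
open import Data.List using ([]; _∷_)
open import Data.List.Relation.Unary.Any using (Any; here; there)
open import Data.Nat using (ℕ; zero; suc; _+_; _≤_; _<_; z≤n; s≤s)
open import Data.Nat.Properties using (≤-antisym; ≤-trans; ≤-reflexive; +-suc; +-monoʳ-≤; <⇒≱; m≤m+n)
open import Data.Product using (Σ; ∃; ∃₂; _×_; _,_; proj₁; proj₂)
open import Data.Sum using (_⊎_; inj₁; inj₂; [_,_]′; swap) renaming (map to ⊎-map)
open import Data.Vec using (tabulate)
open import Data.Vec.Properties using (lookup⇒[]=; []=⇒lookup; lookup∘tabulate)
open import Function using (_∘_; id)
open import Function.Bundles using (_⇔_; mk⇔; Equivalence)
open import Relation.Nullary using (¬_; Dec; yes; no)
open import Relation.Nullary.Decidable using (⌊_⌋; T?; ¬?; _×-dec_; _⊎-dec_; toWitness; fromWitness; toWitnessFalse; fromWitnessFalse)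
open import Relation.Binary.PropositionalEquality using (_≡_; _≢_; refl; sym; trans; subst; subst₂)

open import Defs

open Equivalence using (to; from)

∧-intro : ∀ {a b} → T a → T b → T (a ∧ b)
∧-intro p q = from T-∧ (p , q)

∧-fst : ∀ {a b} → T (a ∧ b) → T a
∧-fst = proj₁ ∘ to T-∧

∧-snd : ∀ {a b} → T (a ∧ b) → T b
∧-snd = proj₂ ∘ to T-∧

not-intro : ∀ {a} → ¬ T a → T (not a)
not-intro {true}  ¬a = ¬a _
not-intro {false} _  = _

not-elim : ∀ {a} → T (not a) → ¬ T a
not-elim {true} ()

no-escape⇒⊆ : ∀ {m} {R R′ : Fin m → Bool} → ¬ (∃ λ x → T (R x) × ¬ T (R′ x)) →
  ∀ x → T (R x) → T (R′ x)
no-escape⇒⊆ {R′ = R′} no-escape x rx with T? (R′ x)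
... | yes r′x = r′x
... | no ¬r′x = ⊥-elim (no-escape (x , rx , ¬r′x))

twoElements : ∀ {m} {a b : Fin m} → a ≢ b → (∀ v → v ≡ a ⊎ v ≡ b) → m ≡ 2
twoElements {m} {a} {b} a≢b cover =
  ≤-antisym (injective⇒≤ {f = label} label-injective) (injective⇒≤ {f = pick} pick-injective)
  where
  label : Fin m → Fin 2
  label v = [ (λ _ → zero) , (λ _ → suc zero) ]′ (cover v)

  label-injective : ∀ {x y} → label x ≡ label y → x ≡ y
  label-injective {x} {y} _  with cover x | cover y
  label-injective         _  | inj₁ refl | inj₁ refl = refl
  label-injective         _  | inj₂ refl | inj₂ refl = refl
  label-injective         () | inj₁ _    | inj₂ _
  label-injective         () | inj₂ _    | inj₁ _

  pick : Fin 2 → Fin m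
  pick zero       = a
  pick (suc zero) = b

  pick-injective : ∀ {i j} → pick i ≡ pick j → i ≡ j
  pick-injective {zero}     {zero}     _   = refl
  pick-injective {suc zero} {suc zero} _   = refl
  pick-injective {zero}     {suc zero} a≡b = ⊥-elim (a≢b a≡b)
  pick-injective {suc zero} {zero}     b≡a = ⊥-elim (a≢b (sym b≡a))

-- An inflationary operator F on subsets of Fin m has a closed set above any
-- starting set R, and every property that F preserves holds of it: the chain
-- R ⊆ F R ⊆ F (F R) ⊆ … grows in size until it stops, which happens within
-- m steps.
module Saturation {m : ℕ} (F : (Fin m → Bool) → Fin m → Bool)
    (inflationary : ∀ R i → T (R i) → T (F R i)) where

  Closed : (Fin m → Bool) → Set
  Closed R = ∀ i → T (F R i) → T (R i)

  size : (Fin m → Bool) → ℕ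
  size R = ∣ tabulate R ∣

  ∈-tabulate : ∀ R {i : Fin m} → T (R i) → i ∈ tabulate R
  ∈-tabulate R {i} r = lookup⇒[]= i (tabulate R) (trans (lookup∘tabulate R i) (to T-≡ r))

  tabulate-∈ : ∀ R {i : Fin m} → i ∈ tabulate R → T (R i)
  tabulate-∈ R {i} r = from T-≡ (trans (sym (lookup∘tabulate R i)) ([]=⇒lookup r))

  grows : ∀ R i → T (F R i) → ¬ T (R i) → size R < size (F R)
  grows R i fr ¬r = p⊂q⇒∣p∣<∣q∣ {p = tabulate R} {q = tabulate (F R)}
    ( ∈-tabulate (F R) ∘ inflationary R _ ∘ tabulate-∈ R
    , i , ∈-tabulate (F R) fr , ¬r ∘ tabulate-∈ R )

  saturate : (P : (Fin m → Bool) → Set) → (∀ R → P R → P (F R)) →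
    ∀ R → P R → Σ (Fin m → Bool) λ Q → P Q × (∀ i → T (R i) → T (Q i)) × Closed Q
  saturate P preserved R = within m R (m≤m+n m (size R))
    where
    -- fuel k suffices as long as m ≤ k + size R
    within : ∀ k R → m ≤ k + size R → P R →
      Σ (Fin m → Bool) λ Q → P Q × (∀ i → T (R i) → T (Q i)) × Closed Q
    within k R bound pR with any? (λ i → T? (F R i) ×-dec ¬? (T? (R i)))
    ... | no ¬escape = R , pR , (λ _ → id) , no-escape⇒⊆ ¬escape
    within zero R bound pR | yes (i , fr , ¬r) =
      ⊥-elim (<⇒≱ (grows R i fr ¬r) (≤-trans (∣p∣≤n (tabulate (F R))) bound))
    within (suc k) R bound pR | yes (i , fr , ¬r) with within k (F R) bound′ (preserved R pR)
      where
      bound′ : m ≤ k + size (F R)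
      bound′ = ≤-trans bound (≤-trans (≤-reflexive (sym (+-suc k (size R))))
                                      (+-monoʳ-≤ k (grows R i fr ¬r)))
    ... | Q , pQ , F[R]⊆Q , closed = Q , pQ , (λ j → F[R]⊆Q j ∘ inflationary R j) , closed

module _ {H : Graph} {S : VSet H} where

  walk-start : ∀ {x y} → Reach H S x y → T (S x)
  walk-start (here s)     = s
  walk-start (step s _ _) = s

  walk-snoc : ∀ {x w v} → Reach H S x w → T (S v) → T (adj H w v) → Reach H S x v
  walk-snoc (here s)     sv e = step s e (here sv)
  walk-snoc (step s a r) sv e = step s a (walk-snoc r sv e)

  walk-closed : (Q : VSet H) → (∀ w v → T (Q w) → T (S v) → T (adj H w v) → T (Q v)) →
    ∀ {x y} → Reach H S x y → T (Q x) → T (Q y)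
  walk-closed Q closed (here _)     q = q
  walk-closed Q closed (step _ e r) q = walk-closed Q closed r (closed _ _ q (walk-start r) e)

-- Reachability inside H[S] from a vertex u ∈ S: saturating {u} under "add
-- the neighbours inside S" yields a set of reachable vertices that is closed
-- under steps, hence consists exactly of the vertices reachable from u.
module Reachability (H : Graph) (S : VSet H) (u : Fin (n H)) (su : T (S u)) where

  neighbours : (Fin (n H) → Bool) → Fin (n H) → Bool
  neighbours R x = R x ∨ (S x ∧ ⌊ any? (λ w → T? (R w ∧ adj H w x)) ⌋)

  open Saturation neighbours (λ R x r → from T-∨ (inj₁ r))

  ReachableSet : (Fin (n H) → Bool) → Set
  ReachableSet R = ∀ x → T (R x) → Reach H S u x

  extend-walks : ∀ R → ReachableSet R → ReachableSet (neighbours R)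
  extend-walks R walks x r with to T-∨ r
  ... | inj₁ rx = walks x rx
  ... | inj₂ sx∧edge with toWitness {a? = any? _} (∧-snd {S x} sx∧edge)
  ... | w , rw∧e = walk-snoc (walks w (∧-fst rw∧e)) (∧-fst sx∧edge) (∧-snd {R w} rw∧e)

  start : ReachableSet (λ x → ⌊ x ≟ u ⌋)
  start x x≡u with toWitness x≡u
  ... | refl = here su

  reachable? : ∀ v → Dec (Reach H S u v)
  reachable? v with saturate ReachableSet extend-walks (λ x → ⌊ x ≟ u ⌋) start
  ... | Q , walks , contains-u , closed with T? (Q v)
  ...   | yes qv = yes (walks v qv)
  ...   | no ¬qv = no λ r → ¬qv (walk-closed Q step-closed r (contains-u u (fromWitness refl)))
    where
    step-closed : ∀ w x → T (Q w) → T (S x) → T (adj H w x) → T (Q x)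
    step-closed w x qw sx e =
      closed x (from T-∨ (inj₂ (∧-intro sx (fromWitness (w , ∧-intro qw e)))))

module _ {G : Graph} where
  private
    H : Graph
    H = complement G

    V : Set
    V = Fin (n G)

  co-edge⇒¬edge : ∀ {a b} → T (adj H a b) → ¬ T (adj G a b)
  co-edge⇒¬edge e = not-elim (∧-fst e)

  ¬co-edge⇒edge : ∀ {a b} → a ≢ b → ¬ T (adj H a b) → T (adj G a b)
  ¬co-edge⇒edge {a} {b} a≢b ¬e with T? (adj G a b)
  ... | yes e  = e
  ... | no ¬ab = ⊥-elim (¬e (∧-intro (not-intro ¬ab) (fromWitnessFalse a≢b)))

  record ProperBiclique : Set where
    constructor proper
    field
      left right     : VSet G
      left-vertex    : ∃ λ a → T (left a)
      right-vertex   : ∃ λ b → T (right b)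
      disjoint       : ∀ v → ¬ (T (left v) × T (right v))
      joined         : ∀ a b → T (left a) → T (right b) → T (adj G a b)
  open ProperBiclique

  _∈P_ : V → ProperBiclique → Set
  v ∈P P = T (left P v) ⊎ T (right P v)

  asBiclique : ProperBiclique → Biclique G
  asBiclique P = complete (left P) (right P) (left-vertex P) (right-vertex P) (disjoint P) (joined P)

  coveredBy : ProperBiclique → Set
  coveredBy P = ∀ v → v ∈P P

  cover⇒BP1 : ∀ P → coveredBy P → BP 1 G
  cover⇒BP1 P cover = asBiclique P ∷ [] , s≤s z≤n , λ v → here (cover v)

  -- The key observation: H has no edge from one side of a biclique of G to
  -- the other, so a walk of H inside the biclique stays in its first side.
  walk-stays-left : ∀ P {S} → (∀ x → T (S x) → x ∈P P) →
    ∀ {x y} → Reach H S x y → T (left P x) → T (left P y)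
  walk-stays-left P {S} inside = walk-closed (left P) stays
    where
    stays : ∀ w v → T (left P w) → T (S v) → T (adj H w v) → T (left P v)
    stays w v lw sv e with inside v sv
    ... | inj₁ lv = lv
    ... | inj₂ rv = ⊥-elim (co-edge⇒¬edge e (joined P w v lw rv))

  no-walk-across : ∀ P {S} → (∀ x → T (S x) → x ∈P P) →
    ∀ {a b} → T (left P a) → T (right P b) → ¬ Reach H S a b
  no-walk-across P inside la rb r = disjoint P _ (walk-stays-left P inside r la , rb)

  separated : ∀ P {S} → (∀ x → T (S x) → x ∈P P) →
    ∀ {a b} → T (left P a) → T (right P b) → T (S a) → T (S b) → DisconnectedOn H S
  separated P inside {a} {b} la rb sa sb = a , b , sa , sb , no-walk-across P inside la rb

  -- Conversely, if H[S] is disconnected then S lies in one biclique of G: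
  -- the component C of u in H[S] against S ∖ C.
  split : ∀ {S} → DisconnectedOn H S → Σ ProperBiclique λ P → ∀ x → T (S x) → x ∈P P
  split {S} (u , v , su , sv , ¬u⇝v) = P , inside
    where
    open Reachability H S u su using (reachable?)

    C : VSet G
    C x = ⌊ reachable? x ⌋

    C-joined : ∀ a b → T (C a) → T (S b ∧ not (C b)) → T (adj G a b)
    C-joined a b ca sb∖c = ¬co-edge⇒edge a≢b ¬e
      where
      ¬cb : ¬ Reach H S u b
      ¬cb = toWitnessFalse (∧-snd {S b} sb∖c)
      a≢b : a ≢ b
      a≢b refl = ¬cb (toWitness ca)
      ¬e : ¬ T (adj H a b)
      ¬e e = ¬cb (walk-snoc (toWitness ca) (∧-fst sb∖c) e)

    P : ProperBiclique
    P = record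
      { left = C
      ; right = λ x → S x ∧ not (C x)
      ; left-vertex = u , fromWitness (here su)
      ; right-vertex = v , ∧-intro sv (fromWitnessFalse ¬u⇝v)
      ; disjoint = λ x (cx , sx∖c) → not-elim (∧-snd {S x} sx∖c) cx
      ; joined = C-joined
      }

    inside : ∀ x → T (S x) → x ∈P P
    inside x sx with T? (C x)
    ... | yes cx = inj₁ cx
    ... | no ¬cx = inj₂ (∧-intro sx (not-intro ¬cx))

  flipSides : ProperBiclique → ProperBiclique
  flipSides (proper A B a b disj join) =
    proper B A b a (λ v (bv , av) → disj v (av , bv))
                   (λ x y bx ay → subst T (adj-sym G y x) (join y x ay bx))

  orient : ∀ P {v} → v ∈P P → Σ ProperBiclique λ P′ → T (left P′ v) × (∀ x → x ∈P P′ ⇔ x ∈P P)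
  orient P (inj₁ lv) = P , lv , λ x → mk⇔ id id
  orient P (inj₂ rv) = flipSides P , rv , λ x → mk⇔ swap swap

  -- If H is connected and G has two distinct vertices then G ∉ BP1: a
  -- singleton cannot hold both, and a proper biclique would separate H.
  connected⇒¬BP1 : Connected H → ∀ {x y : V} → x ≢ y → ¬ BP 1 G
  connected⇒¬BP1 conn {x} _ ([] , _ , cover) with cover x
  ... | ()
  connected⇒¬BP1 conn {x} {y} x≢y (single w ∷ [] , _ , cover) with cover x | cover y
  ... | here x≡w | here y≡w = x≢y (trans x≡w (sym y≡w))
  connected⇒¬BP1 conn _ (complete A B (a , la) (b , rb) disj join ∷ [] , _ , cover) =
    no-walk-across (proper A B (a , la) (b , rb) disj join) inside la rb
                   (proj₂ conn a b _ _)
    where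
    inside : ∀ x → T true → x ∈P proper A B (a , la) (b , rb) disj join
    inside x _ with cover x
    ... | here x∈P = x∈P
  connected⇒¬BP1 conn _ (_ ∷ _ ∷ _ , s≤s () , _)

  -- G ∉ BP1 has a vertex, as the empty graph is covered by no biclique.
  ¬BP1⇒vertex : ¬ BP 1 G → V
  ¬BP1⇒vertex ¬bp1 = proj₁ (¬∀⟶∃¬ (n G) (λ _ → ⊥) (λ _ → no id)
                                   (λ none → ¬bp1 ([] , z≤n , λ v → ⊥-elim (none v))))

  -- If H is disconnected, splitting it covers G by one biclique.
  ¬BP1⇒connected : ¬ BP 1 G → Connected H
  ¬BP1⇒connected ¬bp1 = (¬BP1⇒vertex ¬bp1 , _) , λ u v _ _ → reach u v
    where
    reach : ∀ u v → Reach H (λ _ → true) u v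
    reach u v with Reachability.reachable? H (λ _ → true) u _ v
    ... | yes u⇝v = u⇝v
    ... | no ¬u⇝v with split {S = λ _ → true} (u , v , _ , _ , ¬u⇝v)
    ...   | P , inside = ⊥-elim (¬bp1 (cover⇒BP1 P (λ x → inside x _)))

  uncovered : ¬ BP 1 G → ∀ P → ∃ λ v → ¬ v ∈P P
  uncovered ¬bp1 P = ¬∀⟶∃¬ (n G) (_∈P P) (λ v → T? (left P v) ⊎-dec T? (right P v))
                            (¬bp1 ∘ cover⇒BP1 P)

  cutVertex⇒BP2 : HasCutVertex H → BP 2 G
  cutVertex⇒BP2 (w , H-w-disconnected) with split H-w-disconnected
  ... | P , inside = single w ∷ asBiclique P ∷ [] , s≤s (s≤s z≤n) , cover
    where
    cover : ∀ v → Any (v ∈B_) (single w ∷ asBiclique P ∷ [])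
    cover v with v ≟ w
    ... | yes v≡w = here v≡w
    ... | no v≢w  = there (here (inside v (fromWitnessFalse v≢w)))

  disconnectedCut⇒BP2 : HasDisconnectedVertexCut H → BP 2 G
  disconnectedCut⇒BP2 (X , H-X-disconnected , H[X]-disconnected)
    with split H-X-disconnected | split H[X]-disconnected
  ... | P , in-P | Q , in-Q = asBiclique P ∷ asBiclique Q ∷ [] , s≤s (s≤s z≤n) , cover
    where
    cover : ∀ v → Any (v ∈B_) (asBiclique P ∷ asBiclique Q ∷ [])
    cover v with T? (X v)
    ... | yes xv = there (here (in-Q v xv))
    ... | no ¬xv = here (in-P v (not-intro ¬xv))

  disconnected⇒distinct : ∀ {S} → DisconnectedOn H S → ∃₂ λ (x y : V) → x ≢ y
  disconnected⇒distinct (x , y , sx , _ , ¬x⇝y) = x , y , λ { refl → ¬x⇝y (here sx) }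

  criterion⇒BP2∖BP1 :
    Connected H × (HasCutVertex H ⊎ HasDisconnectedVertexCut H) → BP 2 G × ¬ BP 1 G
  criterion⇒BP2∖BP1 (conn , inj₁ cut@(_ , disc)) =
    cutVertex⇒BP2 cut , connected⇒¬BP1 conn (proj₂ (proj₂ (disconnected⇒distinct disc)))
  criterion⇒BP2∖BP1 (conn , inj₂ cut@(_ , disc , _)) =
    disconnectedCut⇒BP2 cut , connected⇒¬BP1 conn (proj₂ (proj₂ (disconnected⇒distinct disc)))

  -- Two singletons covering G: G is K₁, K₂ (so in BP1) or 2K₁.
  twoSingletons : ¬ IsTwoK1 G → ¬ BP 1 G → ∀ a b → ¬ (∀ v → v ≡ a ⊎ v ≡ b)
  twoSingletons not2K1 ¬bp1 a b cover with a ≟ b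
  ... | yes refl = ¬bp1 (single a ∷ [] , s≤s z≤n , λ v → here ([ id , id ]′ (cover v)))
  ... | no a≢b with T? (adj G a b)
  ...   | yes ab = ¬bp1 (cover⇒BP1 edge edge-covers)
    where
    edge : ProperBiclique
    edge = proper (λ x → ⌊ x ≟ a ⌋) (λ x → ⌊ x ≟ b ⌋) (a , fromWitness refl) (b , fromWitness refl)
      (λ x (x≡a , x≡b) → a≢b (trans (sym (toWitness x≡a)) (toWitness x≡b)))
      (λ x y x≡a y≡b → subst₂ (λ x y → T (adj G x y)) (sym (toWitness x≡a)) (sym (toWitness y≡b)) ab)
    edge-covers : coveredBy edge
    edge-covers v with cover v
    ... | inj₁ refl = inj₁ (fromWitness refl)
    ... | inj₂ refl = inj₂ (fromWitness refl)
  ...   | no ¬ab = not2K1 (twoElements a≢b cover , no-edges)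
    where
    no-edges : ∀ x y → adj G x y ≡ false
    no-edges x y with cover x | cover y
    ... | inj₁ refl | inj₁ refl = adj-irrefl G x
    ... | inj₂ refl | inj₂ refl = adj-irrefl G x
    ... | inj₁ refl | inj₂ refl = to T-not-≡ (not-intro ¬ab)
    ... | inj₂ refl | inj₁ refl = trans (adj-sym G b a) (to T-not-≡ (not-intro ¬ab))

  -- A singleton {a} and a biclique P covering G ∉ BP1: a ∉ P, so H - a lies
  -- inside P and is separated.
  singletonAndProper : ¬ BP 1 G → ∀ a P → (∀ v → v ≡ a ⊎ v ∈P P) → HasCutVertex H
  singletonAndProper ¬bp1 a P cover =
    a , separated P inside (proj₂ (left-vertex P)) (proj₂ (right-vertex P))
                  (off-a (inj₁ (proj₂ (left-vertex P)))) (off-a (inj₂ (proj₂ (right-vertex P))))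
    where
    a∉P : ¬ a ∈P P
    a∉P aP with uncovered ¬bp1 P
    ... | u , u∉P with cover u
    ...   | inj₁ refl = u∉P aP
    ...   | inj₂ uP   = u∉P uP
    off-a : ∀ {x} → x ∈P P → T (not ⌊ x ≟ a ⌋)
    off-a xP = fromWitnessFalse λ { refl → a∉P xP }
    inside : ∀ x → T (not ⌊ x ≟ a ⌋) → x ∈P P
    inside x x≢a with cover x
    ... | inj₁ x≡a = ⊥-elim (toWitnessFalse x≢a x≡a)
    ... | inj₂ xP  = xP

  -- Two bicliques covering G with the same right side R merge into the
  -- single biclique (V ∖ R , R).
  merge : ∀ P Q → (∀ v → v ∈P P ⊎ v ∈P Q) →
    (∀ x → T (right P x) → T (right Q x)) → (∀ x → T (right Q x) → T (right P x)) → BP 1 G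
  merge P Q cover P⊆Q Q⊆P = cover⇒BP1 merged merged-covers
    where
    u : V
    u = proj₁ (left-vertex P)

    join : ∀ x y → T (not (right P x)) → T (right P y) → T (adj G x y)
    join x y ¬rx ry with cover x
    ... | inj₁ (inj₁ lx) = joined P x y lx ry
    ... | inj₁ (inj₂ rx) = ⊥-elim (not-elim ¬rx rx)
    ... | inj₂ (inj₁ lx) = joined Q x y lx (P⊆Q y ry)
    ... | inj₂ (inj₂ rx) = ⊥-elim (not-elim ¬rx (Q⊆P x rx))

    merged : ProperBiclique
    merged = proper (not ∘ right P) (right P)
      (u , not-intro λ ru → disjoint P u (proj₂ (left-vertex P) , ru)) (right-vertex P)
      (λ x (¬rx , rx) → not-elim ¬rx rx) join

    merged-covers : coveredBy merged
    merged-covers x with T? (right P x)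
    ... | yes rx = inj₂ rx
    ... | no ¬rx = inj₁ (not-intro ¬rx)

  -- Bicliques P, Q covering G, with u ∈ left P ∖ Q and w ∈ left Q ∖ P: a
  -- vertex b ∈ right Q ∖ right P makes X = right P ∪ (V ∖ Q) a disconnected
  -- vertex cut, as H - X ⊆ Q contains w and b while H[X] ⊆ P contains u and
  -- a vertex of right P.
  excessCut : ∀ P Q → (∀ v → v ∈P P ⊎ v ∈P Q) →
    ∀ {u w b} → T (left P u) → ¬ u ∈P Q → T (left Q w) → ¬ w ∈P P →
    T (right Q b) → ¬ T (right P b) → HasDisconnectedVertexCut H
  excessCut P Q cover {u} {w} {b} lu u∉Q lw w∉P rb ¬rPb =
    X , separated Q outside lw rb (not-intro w∈X⇒⊥) (not-intro b∈X⇒⊥)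
      , separated P inside lu (proj₂ (right-vertex P))
                  (from T-∨ (inj₂ (not-intro (u∉Q ∘ to T-∨))))
                  (from T-∨ (inj₁ (proj₂ (right-vertex P))))
    where
    X : VSet H
    X x = right P x ∨ not (left Q x ∨ right Q x)

    outside : ∀ x → T (not (X x)) → x ∈P Q
    outside x ¬X with T? (left Q x ∨ right Q x)
    ... | yes xQ = to T-∨ xQ
    ... | no x∉Q = ⊥-elim (not-elim ¬X (from T-∨ (inj₂ (not-intro x∉Q))))

    inside : ∀ x → T (X x) → x ∈P P
    inside x xX with to T-∨ xX | cover x
    ... | inj₁ rx  | _        = inj₂ rx
    ... | inj₂ _   | inj₁ xP  = xP
    ... | inj₂ x∉Q | inj₂ xQ  = ⊥-elim (not-elim x∉Q (from T-∨ xQ))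

    w∈X⇒⊥ : ¬ T (X w)
    w∈X⇒⊥ wX with to T-∨ wX
    ... | inj₁ rw  = w∉P (inj₂ rw)
    ... | inj₂ w∉Q = not-elim w∉Q (from T-∨ (inj₁ lw))

    b∈X⇒⊥ : ¬ T (X b)
    b∈X⇒⊥ bX with to T-∨ bX
    ... | inj₁ rPb = ¬rPb rPb
    ... | inj₂ b∉Q = not-elim b∉Q (from T-∨ (inj₂ rb))

  orientedPair : ¬ BP 1 G → ∀ P Q → (∀ v → v ∈P P ⊎ v ∈P Q) →
    ∀ {u w} → T (left P u) → ¬ u ∈P Q → T (left Q w) → ¬ w ∈P P →
    HasDisconnectedVertexCut H
  orientedPair ¬bp1 P Q cover lu u∉Q lw w∉P
    with any? (λ b → T? (right Q b) ×-dec ¬? (T? (right P b)))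
       | any? (λ b → T? (right P b) ×-dec ¬? (T? (right Q b)))
  ... | yes (_ , rQb , ¬rPb) | _ = excessCut P Q cover lu u∉Q lw w∉P rQb ¬rPb
  ... | no _ | yes (_ , rPb , ¬rQb) = excessCut Q P (swap ∘ cover) lw w∉P lu u∉Q rPb ¬rQb
  ... | no Q⊈P | no P⊈Q = ⊥-elim (¬bp1 (merge P Q cover (no-escape⇒⊆ P⊈Q) (no-escape⇒⊆ Q⊈P)))

  -- Two proper bicliques covering G ∉ BP1: each misses a vertex of the
  -- other; orient both so that these vertices lie on the left.
  properPair : ¬ BP 1 G → ∀ P Q → (∀ v → v ∈P P ⊎ v ∈P Q) → HasDisconnectedVertexCut H
  properPair ¬bp1 P Q cover with uncovered ¬bp1 Q | uncovered ¬bp1 P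
  ... | u , u∉Q | w , w∉P
    with orient P ([ id , ⊥-elim ∘ u∉Q ]′ (cover u)) | orient Q ([ ⊥-elim ∘ w∉P , id ]′ (cover w))
  ... | P′ , lu , P′≈P | Q′ , lw , Q′≈Q =
    orientedPair ¬bp1 P′ Q′ (λ v → ⊎-map (from (P′≈P v)) (from (Q′≈Q v)) (cover v))
                 lu (u∉Q ∘ to (Q′≈Q u)) lw (w∉P ∘ to (P′≈P w))

  twoBicliques : ¬ IsTwoK1 G → ¬ BP 1 G → (c d : Biclique G) → (∀ v → v ∈B c ⊎ v ∈B d) →
    HasCutVertex H ⊎ HasDisconnectedVertexCut H
  twoBicliques not2K1 ¬bp1 (single a) (single b) cover =
    ⊥-elim (twoSingletons not2K1 ¬bp1 a b cover)
  twoBicliques _ ¬bp1 (single a) (complete A B la rb disj join) cover =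
    inj₁ (singletonAndProper ¬bp1 a (proper A B la rb disj join) cover)
  twoBicliques _ ¬bp1 (complete A B la rb disj join) (single a) cover =
    inj₁ (singletonAndProper ¬bp1 a (proper A B la rb disj join) (swap ∘ cover))
  twoBicliques _ ¬bp1 (complete A B la rb disj join) (complete A′ B′ la′ rb′ disj′ join′) cover =
    inj₂ (properPair ¬bp1 (proper A B la rb disj join) (proper A′ B′ la′ rb′ disj′ join′) cover)

  BP2∖BP1⇒criterion : ¬ IsTwoK1 G → BP 2 G × ¬ BP 1 G →
    Connected H × (HasCutVertex H ⊎ HasDisconnectedVertexCut H)
  BP2∖BP1⇒criterion not2K1 ((c ∷ d ∷ [] , _ , cover) , ¬bp1) =
    ¬BP1⇒connected ¬bp1 , twoBicliques not2K1 ¬bp1 c d pair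
    where
    pair : ∀ v → v ∈B c ⊎ v ∈B d
    pair v with cover v
    ... | here v∈c         = inj₁ v∈c
    ... | there (here v∈d) = inj₂ v∈d
  BP2∖BP1⇒criterion _ (([] , _ , cover) , ¬bp1)    = ⊥-elim (¬bp1 ([] , z≤n , cover))
  BP2∖BP1⇒criterion _ ((c ∷ [] , _ , cover) , ¬bp1) = ⊥-elim (¬bp1 (c ∷ [] , s≤s z≤n , cover))
  BP2∖BP1⇒criterion _ ((_ ∷ _ ∷ _ ∷ _ , s≤s (s≤s ()) , _) , _)

lemma2 : (G : Graph) → ¬ IsTwoK1 G →
    (BP 2 G × ¬ BP 1 G) ⇔
    (Connected (complement G) ×
      (HasCutVertex (complement G) ⊎ HasDisconnectedVertexCut (complement G)))
lemma2 G not2K1 = mk⇔ (BP2∖BP1⇒criterion not2K1) criterion⇒BP2∖BP1
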